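{- Let $s\ge 1$ and let $G$ be an $m$-vertex orientation with $\alpha(G)\le s$. Then $G$ has a vertex whose in-degree and out-degree are both at least $m/(4s)-1/2$.
   Context: An orientation is a digraph with no directed cycle of length $2$. The independence number $\alpha(G)$ is that of the underlying undirected graph. -}

module Defs where

open import Data.Nat using (ℕ; _≤_)
open import Data.Bool using (Bool; T)
open import Data.Sum using (_⊎_)
open import Data.Fin using (Fin)
open import Data.Fin.Subset using (Subset; _∈_; ∣_∣)
open import Data.List using (List; length; filter)
open import Data.List using () renaming (allFin to allFinL)
open import Relation.Nullary using (¬_)
open import Relation.Nullary.Decidable using (T?)

-- A digraph on vertex set Fin m, given by its adjacency relation:
-- adj u v = true  iff  there is an arc u → v.
Digraph : ℕ → Set
Digraph m = Fin m → Fin m → Bool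

Arc : ∀ {m} → Digraph m → Fin m → Fin m → Set
Arc G u v = T (G u v)

-- Orientation: no directed cycle of length 2 (and no loops, i.e. a
-- simple digraph; a loop would be excluded by the same condition with u = v).
IsOrientation : ∀ {m} → Digraph m → Set
IsOrientation G = ∀ u v → Arc G u v → ¬ Arc G v u

Adjacent : ∀ {m} → Digraph m → Fin m → Fin m → Set
Adjacent G u v = Arc G u v ⊎ Arc G v u

IsIndependent : ∀ {m} → Digraph m → Subset m → Set
IsIndependent G S = ∀ u v → u ∈ S → v ∈ S → ¬ Adjacent G u v

IndependenceNumber≤ : ∀ {m} → Digraph m → ℕ → Set
IndependenceNumber≤ G s = ∀ S → IsIndependent G S → ∣ S ∣ ≤ s

outdeg : ∀ {m} → Digraph m → Fin m → ℕ
outdeg {m} G u = length (filter (λ v → T? (G u v)) (allFinL m))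

indeg : ∀ {m} → Digraph m → Fin m → ℕ
indeg {m} G v = length (filter (λ u → T? (G u v)) (allFinL m))

-- If m ≤ 2s every vertex works.  Otherwise let t be largest with 4st + 2s < m, and let B be
-- the set of vertices of in-degree at most t.
-- Any W ⊆ B spans at most t|W| arcs, so some vertex of W has at most 2t neighbours in W.
-- Repeatedly taking such a vertex into an independent set and discarding its closed
-- neighbourhood shows |B| ≤ s(2t + 1) < m/2.  By symmetry fewer than m/2 vertices have
-- out-degree at most t, so some vertex has both degrees at least t + 1, and the choice of t
-- gives m ≤ 4s(t + 1) + 2s.
module Submission where

open import Defs
open import Data.Nat using (ℕ; _≤_; _*_; _+_)
open import Data.Fin using (Fin)
open import Data.Product using (Σ; _×_)

open import Data.Bool using (Bool; true; false; T; not; _∧_; _∨_)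
open import Data.Bool.Properties using (T-∨)
open import Data.Empty using (⊥-elim)
open import Data.Fin using (zero; suc; fromℕ<; _≟_)
open import Data.Fin.Subset using (_∈_; ∣_∣)
open import Data.List as List using (length; filter)
open import Data.Nat using (zero; suc; _<_; _∸_; _≤ᵇ_; z≤n; s≤s; NonZero; >-nonZero)
open import Data.Nat.DivMod using (_/_; _%_; m≡m%n+[m/n]*n; m%n<n; m/n*n≤m)
open import Data.Nat.Properties hiding (_≟_)
open import Data.Nat.Tactic.RingSolver using (solve-∀)
open import Data.Product using (_,_; ∃-syntax; proj₁; proj₂)
open import Data.Sum using (_⊎_; inj₁; inj₂; swap)
import Data.Vec as Vec
open import Data.Vec.Properties using ([]=⇒lookup; lookup∘tabulate)
open import Function using (_∘_; Equivalence)
open import Relation.Nullary using (¬_; does; yes; no)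
open import Relation.Nullary.Decidable using (T?)
open import Relation.Binary.PropositionalEquality using (_≡_; refl; sym; trans; cong; subst; subst₂; module ≡-Reasoning)

open import Algebra.Properties.CommutativeSemigroup *-commutativeSemigroup using (x∙yz≈y∙xz)
open import Algebra.Properties.Semiring.Sum +-*-semiring
  using (sum-syntax; sum-replicate-zero; ∑-distrib-+; ∑-comm; *-distribˡ-sum; sum-cong-≗)

⟦_⟧ : Bool → ℕ
⟦ true ⟧ = 1
⟦ false ⟧ = 0

⟦⟧*-≤ : ∀ b n → ⟦ b ⟧ * n ≤ n
⟦⟧*-≤ true n = ≤-reflexive (+-identityʳ n)
⟦⟧*-≤ false n = z≤n

⟦⟧*-mono-≤ : ∀ b {x y} → (T b → x ≤ y) → ⟦ b ⟧ * x ≤ ⟦ b ⟧ * y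
⟦⟧*-mono-≤ true x≤y = *-monoʳ-≤ 1 (x≤y _)
⟦⟧*-mono-≤ false _ = z≤n

⟦⟧*-cancel-< : ∀ b {x y} → ⟦ b ⟧ * x < ⟦ b ⟧ * y → T b × x < y
⟦⟧*-cancel-< true {x} {y} lt = _ , subst₂ _<_ (+-identityʳ x) (+-identityʳ y) lt
⟦⟧*-cancel-< false ()

⟦∨⟧-≤ : ∀ a b → ⟦ a ∨ b ⟧ ≤ ⟦ a ⟧ + ⟦ b ⟧
⟦∨⟧-≤ true b = s≤s z≤n
⟦∨⟧-≤ false b = ≤-refl

∑-mono-≤ : ∀ {n} {f g : Fin n → ℕ} → (∀ i → f i ≤ g i) → ∑[ i < n ] f i ≤ ∑[ i < n ] g i
∑-mono-≤ {zero} _ = z≤n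
∑-mono-≤ {suc n} f≤g = +-mono-≤ (f≤g zero) (∑-mono-≤ (f≤g ∘ suc))

∑-<⇒∃-< : ∀ {n} (f g : Fin n → ℕ) → ∑[ i < n ] f i < ∑[ i < n ] g i → ∃[ i ] f i < g i
∑-<⇒∃-< {suc n} f g lt with f zero <? g zero
... | yes f₀<g₀ = zero , f₀<g₀
... | no f₀≮g₀ with ∑-<⇒∃-< (f ∘ suc) (g ∘ suc) (+-cancelˡ-< (f zero) _ _ (<-≤-trans lt (+-monoˡ-≤ _ (≮⇒≥ f₀≮g₀))))
...   | i , fᵢ<gᵢ = suc i , fᵢ<gᵢ

∑-const : ∀ n c → ∑[ i < n ] c ≡ n * c
∑-const zero c = refl
∑-const (suc n) c = cong (c +_) (∑-const n c)

module _ {m : ℕ} where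

  size : (Fin m → Bool) → ℕ
  size W = ∑[ u < m ] ⟦ W u ⟧

  infix 4 _⊆_
  infixr 6 _∪_

  _⊆_ : (Fin m → Bool) → (Fin m → Bool) → Set
  V ⊆ W = ∀ u → T (V u) → T (W u)

  ∅ : Fin m → Bool
  ∅ _ = false

  ⁅_⁆ : Fin m → Fin m → Bool
  ⁅ v ⁆ u = does (u ≟ v)

  ⁅⁆-sound : ∀ u v → T (⁅ v ⁆ u) → u ≡ v
  ⁅⁆-sound u v with u ≟ v
  ... | yes u≡v = λ _ → u≡v

  _∪_ : (Fin m → Bool) → (Fin m → Bool) → Fin m → Bool
  (V ∪ W) u = V u ∨ W u

  ∪-member : ∀ V W u → T ((V ∪ W) u) → T (V u) ⊎ T (W u)
  ∪-member V W u = Equivalence.to (T-∨ {V u})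

  weighted-size : ∀ W c → ∑[ u < m ] (⟦ W u ⟧ * c) ≡ c * size W
  weighted-size W c = trans (sum-cong-≗ (λ u → *-comm ⟦ W u ⟧ c)) (sym (*-distribˡ-sum c (⟦_⟧ ∘ W)))

  size-∪ : ∀ V W → (∀ u → T (V u) → ¬ T (W u)) → size (V ∪ W) ≡ size V + size W
  size-∪ V W disjoint = trans (sum-cong-≗ (λ u → ⟦∨⟧ (V u) (W u) (disjoint u))) (∑-distrib-+ (⟦_⟧ ∘ V) (⟦_⟧ ∘ W))
    where
      ⟦∨⟧ : ∀ a b → (T a → ¬ T b) → ⟦ a ∨ b ⟧ ≡ ⟦ a ⟧ + ⟦ b ⟧
      ⟦∨⟧ true true a⇒¬b = ⊥-elim (a⇒¬b _ _)
      ⟦∨⟧ true false _ = refl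
      ⟦∨⟧ false b _ = refl

  ∃-outside-both : ∀ V W → size V + size W < m → ∃[ u ] ¬ T (V u) × ¬ T (W u)
  ∃-outside-both V W small with ∑-<⇒∃-< (λ u → ⟦ V u ⟧ + ⟦ W u ⟧) (λ _ → 1) small′
    where
      small′ : ∑[ u < m ] (⟦ V u ⟧ + ⟦ W u ⟧) < ∑[ u < m ] 1
      small′ = subst₂ _<_ (sym (∑-distrib-+ (⟦_⟧ ∘ V) (⟦_⟧ ∘ W))) (sym (trans (∑-const m 1) (*-identityʳ m))) small
  ... | u , lt = u , outside (V u) (W u) lt
    where
      outside : ∀ a b → ⟦ a ⟧ + ⟦ b ⟧ < 1 → ¬ T a × ¬ T b
      outside false false _ = (λ ()) , (λ ())
      outside true b (s≤s ())
      outside false true (s≤s ())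

size-⁅⁆ : ∀ {m} (v : Fin m) → size ⁅ v ⁆ ≡ 1
size-⁅⁆ {suc m} zero = cong suc (sum-replicate-zero m)
size-⁅⁆ {suc m} (suc v) = size-⁅⁆ {m} v

∃-≤-average : ∀ {m} (W : Fin m → Bool) (f : Fin m → ℕ) c → 0 < size W →
              ∑[ u < m ] (⟦ W u ⟧ * f u) ≤ c * size W → ∃[ u ] T (W u) × f u ≤ c
∃-≤-average {m} W f c W≢∅ ∑≤ with ∑-<⇒∃-< (λ u → ⟦ W u ⟧ * f u) (λ u → ⟦ W u ⟧ * suc c) ∑<
  where
    ∑< : ∑[ u < m ] (⟦ W u ⟧ * f u) < ∑[ u < m ] (⟦ W u ⟧ * suc c)
    ∑< = begin-strict
      ∑[ u < m ] (⟦ W u ⟧ * f u)  ≤⟨ ∑≤ ⟩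
      c * size W                <⟨ m<n+m (c * size W) W≢∅ ⟩
      suc c * size W            ≡⟨ weighted-size W (suc c) ⟨
      ∑[ u < m ] (⟦ W u ⟧ * suc c) ∎
      where open ≤-Reasoning
... | u , lt with ⟦⟧*-cancel-< (W u) lt
...   | u∈W , s≤s fᵤ≤c = u , u∈W , fᵤ≤c

module Degeneracy {m} (adj : Fin m → Fin m → Bool) where

  deg : (Fin m → Bool) → Fin m → ℕ
  deg W v = ∑[ u < m ] (⟦ W u ⟧ * ⟦ adj u v ⟧)

  Independent : (Fin m → Bool) → Set
  Independent I = ∀ u v → T (I u) → T (I v) → ¬ T (adj u v)

  Degenerate : ℕ → (Fin m → Bool) → Set
  Degenerate k B = ∀ W → W ⊆ B → 0 < size W → ∃[ v ] T (W v) × deg W v ≤ k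

  infixl 9 _∖N[_]

  _∖N[_] : (Fin m → Bool) → Fin m → Fin m → Bool
  (W ∖N[ v ]) u = W u ∧ not (⁅ v ⁆ u ∨ adj u v)

  ∖N-member : ∀ W v u → T ((W ∖N[ v ]) u) → T (W u) × ¬ T (⁅ v ⁆ u) × ¬ T (adj u v)
  ∖N-member W v u t with W u | ⁅ v ⁆ u | adj u v
  ... | true | false | false = _ , (λ ()) , (λ ())

  size-∖N : ∀ W v → size W ≤ size (W ∖N[ v ]) + suc (deg W v)
  size-∖N W v = begin
    size W
      ≤⟨ ∑-mono-≤ (λ u → split (W u) (⁅ v ⁆ u) (adj u v)) ⟩
    ∑[ u < m ] (⟦ (W ∖N[ v ]) u ⟧ + (⟦ ⁅ v ⁆ u ⟧ + ⟦ W u ⟧ * ⟦ adj u v ⟧))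
      ≡⟨ ∑-distrib-+ (⟦_⟧ ∘ (W ∖N[ v ])) _ ⟩
    size (W ∖N[ v ]) + ∑[ u < m ] (⟦ ⁅ v ⁆ u ⟧ + ⟦ W u ⟧ * ⟦ adj u v ⟧)
      ≡⟨ cong (size (W ∖N[ v ]) +_) (trans (∑-distrib-+ (⟦_⟧ ∘ ⁅ v ⁆) _) (cong (_+ deg W v) (size-⁅⁆ v))) ⟩
    size (W ∖N[ v ]) + suc (deg W v) ∎
    where
      open ≤-Reasoning
      split : ∀ w e a → ⟦ w ⟧ ≤ ⟦ w ∧ not (e ∨ a) ⟧ + (⟦ e ⟧ + ⟦ w ⟧ * ⟦ a ⟧)
      split false e a = z≤n
      split true false false = ≤-refl
      split true true a = s≤s z≤n
      split true false true = s≤s z≤n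

  module _ (adj-sym : ∀ {u v} → T (adj u v) → T (adj v u)) (adj-irrefl : ∀ v → ¬ T (adj v v)) where

    extend-independent : ∀ {W v I} → T (W v) → I ⊆ W ∖N[ v ] → Independent I →
                         (⁅ v ⁆ ∪ I) ⊆ W × Independent (⁅ v ⁆ ∪ I) × size (⁅ v ⁆ ∪ I) ≡ suc (size I)
    extend-independent {W} {v} {I} v∈W I⊆W∖N I-indep = ⊆W , indep , trans (size-∪ ⁅ v ⁆ I v∉I) (cong (_+ size I) (size-⁅⁆ v))
      where
        member : ∀ {u} → T (I u) → T (W u) × ¬ T (⁅ v ⁆ u) × ¬ T (adj u v)
        member {u} u∈I = ∖N-member W v u (I⊆W∖N u u∈I)
        v∉I : ∀ u → T (⁅ v ⁆ u) → ¬ T (I u)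
        v∉I u u∈⁅v⁆ u∈I = proj₁ (proj₂ (member u∈I)) u∈⁅v⁆
        ⊆W : (⁅ v ⁆ ∪ I) ⊆ W
        ⊆W u t with ∪-member ⁅ v ⁆ I u t
        ... | inj₁ u∈⁅v⁆ = subst (T ∘ W) (sym (⁅⁆-sound u v u∈⁅v⁆)) v∈W
        ... | inj₂ u∈I = proj₁ (member u∈I)
        indep : Independent (⁅ v ⁆ ∪ I)
        indep u w tu tw with ∪-member ⁅ v ⁆ I u tu | ∪-member ⁅ v ⁆ I w tw
        ... | inj₁ u∈⁅v⁆ | inj₁ w∈⁅v⁆ rewrite ⁅⁆-sound u v u∈⁅v⁆ | ⁅⁆-sound w v w∈⁅v⁆ = adj-irrefl v
        ... | inj₁ u∈⁅v⁆ | inj₂ w∈I rewrite ⁅⁆-sound u v u∈⁅v⁆ = proj₂ (proj₂ (member w∈I)) ∘ adj-sym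
        ... | inj₂ u∈I | inj₁ w∈⁅v⁆ rewrite ⁅⁆-sound w v w∈⁅v⁆ = proj₂ (proj₂ (member u∈I))
        ... | inj₂ u∈I | inj₂ w∈I = I-indep u w u∈I w∈I

    large-independent-subset : ∀ {k B} → Degenerate k B → ∀ j W → W ⊆ B → j * suc k < size W →
                               ∃[ I ] I ⊆ W × Independent I × j < size I
    large-independent-subset {k} degenerate j W W⊆B large with degenerate W W⊆B (≤-<-trans z≤n large)
    ... | v , v∈W , deg≤k = extended (rest j large)
      where
        W′ = W ∖N[ v ]
        rest : ∀ j → j * suc k < size W → ∃[ I ] I ⊆ W′ × Independent I × j ≤ size I
        rest zero _ = ∅ , (λ _ ()) , (λ _ _ ()) , z≤n
        rest (suc j) large = large-independent-subset degenerate j W′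
          (λ u → W⊆B u ∘ proj₁ ∘ ∖N-member W v u)
          (+-cancelʳ-< (suc k) (j * suc k) (size W′) (begin-strict
            j * suc k + suc k        ≡⟨ +-comm (j * suc k) (suc k) ⟩
            suc j * suc k            <⟨ large ⟩
            size W                   ≤⟨ size-∖N W v ⟩
            size W′ + suc (deg W v)  ≤⟨ +-monoʳ-≤ (size W′) (s≤s deg≤k) ⟩
            size W′ + suc k          ∎))
          where open ≤-Reasoning
        extended : (∃[ I ] I ⊆ W′ × Independent I × j ≤ size I) → ∃[ I ] I ⊆ W × Independent I × j < size I
        extended (I , I⊆W′ , I-indep , j≤∣I∣) with extend-independent v∈W I⊆W′ I-indep
        ... | ⊆W , indep , ∣vI∣≡1+∣I∣ = ⁅ v ⁆ ∪ I , ⊆W , indep , subst (j <_) (sym ∣vI∣≡1+∣I∣) (s≤s j≤∣I∣)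

    degenerate-size-bound : ∀ {k B s} → Degenerate k B → (∀ I → Independent I → size I ≤ s) → size B ≤ s * suc k
    degenerate-size-bound {B = B} {s} degenerate α≤s = ≮⇒≥ λ large →
      let I , _ , I-indep , s<∣I∣ = large-independent-subset degenerate s B (λ _ t → t) large
      in <⇒≱ s<∣I∣ (α≤s I I-indep)

length-filter-tabulate : ∀ {A : Set} {n} (p : A → Bool) (f : Fin n → A) →
                         length (filter (T? ∘ p) (List.tabulate f)) ≡ ∑[ i < n ] ⟦ p (f i) ⟧
length-filter-tabulate {n = zero} p f = refl
length-filter-tabulate {n = suc n} p f with p (f zero)
... | true = cong suc (length-filter-tabulate p (f ∘ suc))
... | false = length-filter-tabulate p (f ∘ suc)

∣tabulate∣ : ∀ {n} (I : Fin n → Bool) → ∣ Vec.tabulate I ∣ ≡ size I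
∣tabulate∣ {zero} I = refl
∣tabulate∣ {suc n} I with I zero
... | true = cong suc (∣tabulate∣ (I ∘ suc))
... | false = ∣tabulate∣ (I ∘ suc)

module _ {m} (G : Digraph m) where

  underlying : Fin m → Fin m → Bool
  underlying u v = G u v ∨ G v u

  open Degeneracy underlying

  underlying-sym : ∀ {u v} → T (underlying u v) → T (underlying v u)
  underlying-sym {u} {v} = Equivalence.from (T-∨ {G v u}) ∘ swap ∘ Equivalence.to (T-∨ {G u v})

  underlying-irrefl : IsOrientation G → ∀ v → ¬ T (underlying v v)
  underlying-irrefl orient v loop with Equivalence.to (T-∨ {G v v}) loop
  ... | inj₁ a = orient v v a a
  ... | inj₂ a = orient v v a a

  indeg≡∑ : ∀ v → indeg G v ≡ ∑[ u < m ] ⟦ G u v ⟧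
  indeg≡∑ v = length-filter-tabulate (λ u → G u v) (λ u → u)

  arcsInto arcsFrom : (Fin m → Bool) → Fin m → ℕ
  arcsInto W v = ∑[ u < m ] (⟦ W u ⟧ * ⟦ G u v ⟧)
  arcsFrom W v = ∑[ u < m ] (⟦ W u ⟧ * ⟦ G v u ⟧)

  arcsInto≤indeg : ∀ W v → arcsInto W v ≤ indeg G v
  arcsInto≤indeg W v = ≤-trans (∑-mono-≤ (λ u → ⟦⟧*-≤ (W u) ⟦ G u v ⟧)) (≤-reflexive (sym (indeg≡∑ v)))

  deg≤arcsInto+arcsFrom : ∀ W v → deg W v ≤ arcsInto W v + arcsFrom W v
  deg≤arcsInto+arcsFrom W v = begin
    deg W v
      ≤⟨ ∑-mono-≤ (λ u → *-monoʳ-≤ ⟦ W u ⟧ (⟦∨⟧-≤ (G u v) (G v u))) ⟩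
    ∑[ u < m ] (⟦ W u ⟧ * (⟦ G u v ⟧ + ⟦ G v u ⟧))
      ≡⟨ sum-cong-≗ (λ u → *-distribˡ-+ ⟦ W u ⟧ ⟦ G u v ⟧ ⟦ G v u ⟧) ⟩
    ∑[ u < m ] (⟦ W u ⟧ * ⟦ G u v ⟧ + ⟦ W u ⟧ * ⟦ G v u ⟧)
      ≡⟨ ∑-distrib-+ (λ u → ⟦ W u ⟧ * ⟦ G u v ⟧) (λ u → ⟦ W u ⟧ * ⟦ G v u ⟧) ⟩
    arcsInto W v + arcsFrom W v ∎
    where open ≤-Reasoning

  -- Both sides count the arcs of G inside W.
  handshake : ∀ W → ∑[ v < m ] (⟦ W v ⟧ * arcsFrom W v) ≡ ∑[ v < m ] (⟦ W v ⟧ * arcsInto W v)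
  handshake W = begin
    ∑[ v < m ] (⟦ W v ⟧ * arcsFrom W v)
      ≡⟨ sum-cong-≗ (λ v → *-distribˡ-sum ⟦ W v ⟧ (λ u → ⟦ W u ⟧ * ⟦ G v u ⟧)) ⟩
    ∑[ v < m ] ∑[ u < m ] (⟦ W v ⟧ * (⟦ W u ⟧ * ⟦ G v u ⟧))
      ≡⟨ ∑-comm (λ v u → ⟦ W v ⟧ * (⟦ W u ⟧ * ⟦ G v u ⟧)) ⟩
    ∑[ u < m ] ∑[ v < m ] (⟦ W v ⟧ * (⟦ W u ⟧ * ⟦ G v u ⟧))
      ≡⟨ sum-cong-≗ (λ u → sum-cong-≗ (λ v → x∙yz≈y∙xz ⟦ W v ⟧ ⟦ W u ⟧ ⟦ G v u ⟧)) ⟩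
    ∑[ u < m ] ∑[ v < m ] (⟦ W u ⟧ * (⟦ W v ⟧ * ⟦ G v u ⟧))
      ≡⟨ sum-cong-≗ (λ u → *-distribˡ-sum ⟦ W u ⟧ (λ v → ⟦ W v ⟧ * ⟦ G v u ⟧)) ⟨
    ∑[ u < m ] (⟦ W u ⟧ * arcsInto W u) ∎
    where open ≡-Reasoning

  low-indegree-degenerate : ∀ t → Degenerate (2 * t) (λ v → indeg G v ≤ᵇ t)
  low-indegree-degenerate t W W⊆low W≢∅ = ∃-≤-average W (deg W) (2 * t) W≢∅ (begin
    ∑[ v < m ] (⟦ W v ⟧ * deg W v)
      ≤⟨ ∑-mono-≤ (λ v → *-monoʳ-≤ ⟦ W v ⟧ (deg≤arcsInto+arcsFrom W v)) ⟩
    ∑[ v < m ] (⟦ W v ⟧ * (arcsInto W v + arcsFrom W v))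
      ≡⟨ sum-cong-≗ (λ v → *-distribˡ-+ ⟦ W v ⟧ (arcsInto W v) (arcsFrom W v)) ⟩
    ∑[ v < m ] (⟦ W v ⟧ * arcsInto W v + ⟦ W v ⟧ * arcsFrom W v)
      ≡⟨ ∑-distrib-+ (λ v → ⟦ W v ⟧ * arcsInto W v) (λ v → ⟦ W v ⟧ * arcsFrom W v) ⟩
    ∑[ v < m ] (⟦ W v ⟧ * arcsInto W v) + ∑[ v < m ] (⟦ W v ⟧ * arcsFrom W v)
      ≡⟨ cong (∑[ v < m ] (⟦ W v ⟧ * arcsInto W v) +_) (handshake W) ⟩
    ∑[ v < m ] (⟦ W v ⟧ * arcsInto W v) + ∑[ v < m ] (⟦ W v ⟧ * arcsInto W v)
      ≤⟨ +-mono-≤ into≤ into≤ ⟩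
    t * size W + t * size W
      ≡⟨ cong (t * size W +_) (+-identityʳ (t * size W)) ⟨
    2 * (t * size W)
      ≡⟨ *-assoc 2 t (size W) ⟨
    2 * t * size W ∎)
    where
      open ≤-Reasoning
      into≤ : ∑[ v < m ] (⟦ W v ⟧ * arcsInto W v) ≤ t * size W
      into≤ = ≤-trans (∑-mono-≤ (λ v → ⟦⟧*-mono-≤ (W v) (λ v∈W →
                ≤-trans (arcsInto≤indeg W v) (≤ᵇ⇒≤ (indeg G v) t (W⊆low v v∈W)))))
                (≤-reflexive (weighted-size W t))

  independent-size-bound : ∀ {s} → IndependenceNumber≤ G s → ∀ I → Independent I → size I ≤ s
  independent-size-bound α≤s I I-indep = subst (_≤ _) (∣tabulate∣ I) (α≤s (Vec.tabulate I) independent)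
    where
      member : ∀ {u} → u ∈ Vec.tabulate I → T (I u)
      member {u} u∈I = subst T (trans (sym ([]=⇒lookup u∈I)) (lookup∘tabulate I u)) _
      independent : IsIndependent G (Vec.tabulate I)
      independent u v u∈I v∈I = I-indep u v (member u∈I) (member v∈I) ∘ Equivalence.from (T-∨ {G u v})

  low-indegree-size-bound : ∀ {s} → IsOrientation G → IndependenceNumber≤ G s → ∀ t →
                     size (λ v → indeg G v ≤ᵇ t) ≤ s * suc (2 * t)
  low-indegree-size-bound orient α≤s t =
    degenerate-size-bound underlying-sym (underlying-irrefl orient) (low-indegree-degenerate t) (independent-size-bound α≤s)

_ᵀ : ∀ {m} → Digraph m → Digraph m
(G ᵀ) u v = G v u

ᵀ-orientation : ∀ {m} {G : Digraph m} → IsOrientation G → IsOrientation (G ᵀ)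
ᵀ-orientation orient u v = orient v u

ᵀ-independence : ∀ {m s} {G : Digraph m} → IndependenceNumber≤ G s → IndependenceNumber≤ (G ᵀ) s
ᵀ-independence α≤s S S-indep = α≤s S (λ u v u∈S v∈S → S-indep u v u∈S v∈S ∘ swap)

low-outdegree-size-bound : ∀ {m s} (G : Digraph m) → IsOrientation G → IndependenceNumber≤ G s → ∀ t →
                           size (λ v → outdeg G v ≤ᵇ t) ≤ s * suc (2 * t)
low-outdegree-size-bound G orient α≤s = low-indegree-size-bound (G ᵀ) (ᵀ-orientation orient) (ᵀ-independence α≤s)

∃-high-in-and-out-degree : ∀ {m s t} (G : Digraph m) → IsOrientation G → IndependenceNumber≤ G s →
                           2 * (s * suc (2 * t)) < m → ∃[ v ] t < indeg G v × t < outdeg G v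
∃-high-in-and-out-degree {m} {s} {t} G orient α≤s large =
  let v , in-high , out-high = ∃-outside-both (λ v → indeg G v ≤ᵇ t) (λ v → outdeg G v ≤ᵇ t) few-low
  in v , ≰ᵇ⇒> in-high , ≰ᵇ⇒> out-high
  where
    few-low : size (λ v → indeg G v ≤ᵇ t) + size (λ v → outdeg G v ≤ᵇ t) < m
    few-low = begin-strict
      size (λ v → indeg G v ≤ᵇ t) + size (λ v → outdeg G v ≤ᵇ t)
        ≤⟨ +-mono-≤ (low-indegree-size-bound G orient α≤s t) (low-outdegree-size-bound G orient α≤s t) ⟩
      s * suc (2 * t) + s * suc (2 * t)  ≡⟨ cong (s * suc (2 * t) +_) (+-identityʳ (s * suc (2 * t))) ⟨
      2 * (s * suc (2 * t))              <⟨ large ⟩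
      m                                  ∎
      where open ≤-Reasoning
    ≰ᵇ⇒> : ∀ {d} → ¬ T (d ≤ᵇ t) → t < d
    ≰ᵇ⇒> d≰t = ≰⇒> (d≰t ∘ ≤⇒≤ᵇ)

∃-floor : ∀ a b n → 0 < a → b < n → ∃[ t ] a * t + b < n × n ≤ a * suc t + b
∃-floor a b n a>0 b<n = q , lower , upper
  where
    instance
      a≢0 : NonZero a
      a≢0 = >-nonZero a>0
    r = n ∸ suc b
    q = r / a
    r+[1+b]≡n : r + suc b ≡ n
    r+[1+b]≡n = m∸n+n≡m b<n
    lower : a * q + b < n
    lower = begin-strict
      a * q + b      <⟨ +-monoʳ-< (a * q) (n<1+n b) ⟩
      a * q + suc b  ≤⟨ +-monoˡ-≤ (suc b) (≤-trans (≤-reflexive (*-comm a q)) (m/n*n≤m r a)) ⟩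
      r + suc b      ≡⟨ r+[1+b]≡n ⟩
      n              ∎
      where open ≤-Reasoning
    upper : n ≤ a * suc q + b
    upper = begin
      n              ≡⟨ r+[1+b]≡n ⟨
      r + suc b      ≡⟨ +-suc r b ⟩
      suc r + b      ≤⟨ +-monoˡ-≤ b r<a[1+q] ⟩
      a * suc q + b  ∎
      where
        open ≤-Reasoning
        r<a[1+q] : r < a * suc q
        r<a[1+q] = begin-strict
          r              ≡⟨ m≡m%n+[m/n]*n r a ⟩
          r % a + q * a  <⟨ +-monoˡ-< (q * a) (m%n<n r a) ⟩
          a + q * a      ≡⟨ cong (a +_) (*-comm q a) ⟩
          a + a * q      ≡⟨ *-suc a q ⟨
          a * suc q      ∎

4st+2s≡2[s[1+2t]] : ∀ s t → 4 * s * t + 2 * s ≡ 2 * (s * suc (2 * t))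
4st+2s≡2[s[1+2t]] = solve-∀

lemma2p4 : (s m : ℕ) → 1 ≤ s → 1 ≤ m → (G : Digraph m) → IsOrientation G → IndependenceNumber≤ G s → Σ (Fin m) (λ v → (m ≤ 4 * s * indeg G v + 2 * s) × (m ≤ 4 * s * outdeg G v + 2 * s))
lemma2p4 s m s≥1 m≥1 G orient α≤s with m ≤? 2 * s
... | yes m≤2s = fromℕ< m≥1 , m≤4sd+2s _ , m≤4sd+2s _
  where
    m≤4sd+2s : ∀ d → m ≤ 4 * s * d + 2 * s
    m≤4sd+2s d = ≤-trans m≤2s (m≤n+m (2 * s) (4 * s * d))
... | no m≰2s =
  let t , 4st+2s<m , m≤4s[1+t]+2s = ∃-floor (4 * s) (2 * s) m (≤-trans s≥1 (m≤n*m s 4)) (≰⇒> m≰2s)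
      v , t<in , t<out = ∃-high-in-and-out-degree G orient α≤s (subst (_< m) (4st+2s≡2[s[1+2t]] s t) 4st+2s<m)
      bound : ∀ {d} → t < d → m ≤ 4 * s * d + 2 * s
      bound t<d = ≤-trans m≤4s[1+t]+2s (+-monoˡ-≤ (2 * s) (*-monoʳ-≤ (4 * s) t<d))
  in v , bound t<in , bound t<out
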